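{- For all integers $n\geq 1$ and $p\geq 0$, \[ \sum_{k=0}^{n}\binom{n+1}{k}B_{k,p}=-p\,B_{n,p}. \]
   Context: For each integer $p\geq 0$, the $p$-Bernoulli numbers $B_{n,p}$ ($n\geq 0$) are defined by $B_{0,p}=1$ and the recurrence $B_{n+1,p}=pB_{n,p}-\frac{(p+1)^{2}}{p+2}B_{n,p+1}$ for $n\geq 0$, $p\geq 0$. For $p=0$ they reduce to the classical Bernoulli numbers $B_n$ (given by $\sum_{n\ge0}B_n t^n/n! = t/(e^t-1)$). -}

module Defs where

open import Data.Nat as ℕ using (ℕ; zero; suc)
open import Data.Integer as ℤ using (ℤ; +_)
open import Data.Rational using (ℚ; 0ℚ; 1ℚ; _+_; _*_; -_; _/_)
open import Data.Nat.Combinatorics using (_C_)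

ℕtoℚ : ℕ → ℚ
ℕtoℚ n = (+ n) / 1

B : ℕ → ℕ → ℚ
B zero    p = 1ℚ
B (suc n) p = ℕtoℚ p * B n p + - (((+ ((suc p) ℕ.* (suc p))) / (suc (suc p))) * B n (suc p))

Σ≤ : ℕ → (ℕ → ℚ) → ℚ
Σ≤ zero    f = f 0
Σ≤ (suc n) f = Σ≤ n f + f (suc n)

-- Let T n f = Σ_{k ≤ n} (n choose k) f k be the binomial transform. Pascal's rule gives
-- T (n+1) f = T n f + T n (f ∘ suc), and feeding in the defining recurrence of B yields
-- T (n+1) B_{·,p} = (p+1) T n B_{·,p} − c_p T n B_{·,p+1}, with c_p = (p+1)²/(p+2).
-- This is the recurrence of B itself shifted to p+1, so by induction on n (for all p at once)
-- T (n+2) B_{·,p} = − c_p B_{n+1,p+1} = B_{n+2,p} − p B_{n+1,p}; the base case n = 0 is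
-- c_p (p+2) = (p+1)². Removing the top term B_{n+2,p} from T (n+2) gives the theorem.
module Submission where

open import Defs
open import Data.Nat as ℕ using (ℕ; zero; suc; _≥_)
import Data.Nat.Properties as ℕ
open import Data.Nat.Combinatorics using (_C_; nCn≡1; nCk+nC[k+1]≡[n+1]C[k+1])
open import Data.Nat.Combinatorics.Specification using (k>n⇒nCk≡0)
import Data.Integer as ℤ
import Data.Integer.Properties as ℤ
open import Data.Rational using (ℚ; 0ℚ; 1ℚ; _+_; _*_; -_; _/_; toℚᵘ)
open import Data.Rational.Properties
  using ( _≟_; +-*-commutativeRing; +-assoc; +-identityˡ; +-identityʳ
        ; +-inverseʳ; *-identityˡ; *-zeroˡ; *-distribˡ-+; *-distribʳ-+; neg-distrib-+
        ; toℚᵘ-injective; toℚᵘ-fromℚᵘ; toℚᵘ-homo-+; toℚᵘ-homo-* )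
open import Data.Rational.Unnormalised as ℚᵘ using (mkℚᵘ; _≃_; *≡*)
import Data.Rational.Unnormalised.Properties as ℚᵘ
open import Level using (0ℓ)
open import Relation.Nullary.Decidable.Core using (dec⇒maybe)
open import Function.Base using (flip)
open import Relation.Binary.PropositionalEquality
  using (_≡_; refl; sym; trans; cong; cong₂; module ≡-Reasoning)
open import Tactic.RingSolver using (solve-∀)
open import Tactic.RingSolver.Core.AlmostCommutativeRing
  using (AlmostCommutativeRing; fromCommutativeRing)

ℚ-ring : AlmostCommutativeRing 0ℓ 0ℓ
ℚ-ring = fromCommutativeRing +-*-commutativeRing (λ q → dec⇒maybe (0ℚ ≟ q))

toℚᵘ-ℕtoℚ : ∀ n → toℚᵘ (ℕtoℚ n) ≃ mkℚᵘ (ℤ.+ n) 0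
toℚᵘ-ℕtoℚ n = toℚᵘ-fromℚᵘ (mkℚᵘ (ℤ.+ n) 0)

ℕtoℚ-+ : ∀ m n → ℕtoℚ (m ℕ.+ n) ≡ ℕtoℚ m + ℕtoℚ n
ℕtoℚ-+ m n = toℚᵘ-injective (begin
  toℚᵘ (ℕtoℚ (m ℕ.+ n))               ≈⟨ toℚᵘ-ℕtoℚ (m ℕ.+ n) ⟩
  mkℚᵘ (ℤ.+ (m ℕ.+ n)) 0              ≈⟨ *≡* (cong (ℤ._* ℤ.+ 1) (trans (ℤ.pos-+ m n) numerator)) ⟩
  mkℚᵘ (ℤ.+ m) 0 ℚᵘ.+ mkℚᵘ (ℤ.+ n) 0  ≈⟨ ℚᵘ.+-cong (toℚᵘ-ℕtoℚ m) (toℚᵘ-ℕtoℚ n) ⟨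
  toℚᵘ (ℕtoℚ m) ℚᵘ.+ toℚᵘ (ℕtoℚ n)    ≈⟨ toℚᵘ-homo-+ (ℕtoℚ m) (ℕtoℚ n) ⟨
  toℚᵘ (ℕtoℚ m + ℕtoℚ n)              ∎)
  where
  open ℚᵘ.≃-Reasoning
  numerator : ℤ.+ m ℤ.+ ℤ.+ n ≡ ℤ.+ m ℤ.* ℤ.+ 1 ℤ.+ ℤ.+ n ℤ.* ℤ.+ 1
  numerator = sym (cong₂ ℤ._+_ (ℤ.*-identityʳ (ℤ.+ m)) (ℤ.*-identityʳ (ℤ.+ n)))

ℕtoℚ-suc : ∀ n → ℕtoℚ (suc n) ≡ 1ℚ + ℕtoℚ n
ℕtoℚ-suc = ℕtoℚ-+ 1

ℕtoℚ-* : ∀ m n → ℕtoℚ (m ℕ.* n) ≡ ℕtoℚ m * ℕtoℚ n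
ℕtoℚ-* m n = toℚᵘ-injective (begin
  toℚᵘ (ℕtoℚ (m ℕ.* n))               ≈⟨ toℚᵘ-ℕtoℚ (m ℕ.* n) ⟩
  mkℚᵘ (ℤ.+ (m ℕ.* n)) 0              ≈⟨ *≡* (cong (ℤ._* ℤ.+ 1) (ℤ.pos-* m n)) ⟩
  mkℚᵘ (ℤ.+ m) 0 ℚᵘ.* mkℚᵘ (ℤ.+ n) 0  ≈⟨ ℚᵘ.*-cong (toℚᵘ-ℕtoℚ m) (toℚᵘ-ℕtoℚ n) ⟨
  toℚᵘ (ℕtoℚ m) ℚᵘ.* toℚᵘ (ℕtoℚ n)    ≈⟨ toℚᵘ-homo-* (ℕtoℚ m) (ℕtoℚ n) ⟨
  toℚᵘ (ℕtoℚ m * ℕtoℚ n)              ∎)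
  where open ℚᵘ.≃-Reasoning

/-*-cancel : ∀ m d → (ℤ.+ m / suc d) * ℕtoℚ (suc d) ≡ ℕtoℚ m
/-*-cancel m d = toℚᵘ-injective (begin
  toℚᵘ ((ℤ.+ m / suc d) * ℕtoℚ (suc d))
    ≈⟨ toℚᵘ-homo-* (ℤ.+ m / suc d) (ℕtoℚ (suc d)) ⟩
  toℚᵘ (ℤ.+ m / suc d) ℚᵘ.* toℚᵘ (ℕtoℚ (suc d))
    ≈⟨ ℚᵘ.*-cong (toℚᵘ-fromℚᵘ (mkℚᵘ (ℤ.+ m) d)) (toℚᵘ-ℕtoℚ (suc d)) ⟩
  mkℚᵘ (ℤ.+ m) d ℚᵘ.* mkℚᵘ (ℤ.+ suc d) 0
    ≈⟨ *≡* cross-multiplied ⟩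
  mkℚᵘ (ℤ.+ m) 0
    ≈⟨ toℚᵘ-ℕtoℚ m ⟨
  toℚᵘ (ℕtoℚ m)
    ∎)
  where
  open ℚᵘ.≃-Reasoning
  cross-multiplied : (ℤ.+ m ℤ.* ℤ.+ suc d) ℤ.* ℤ.+ 1 ≡ ℤ.+ m ℤ.* ℤ.+ suc (d ℕ.* 1)
  cross-multiplied = trans (ℤ.*-identityʳ (ℤ.+ m ℤ.* ℤ.+ suc d))
                           (cong (λ e → ℤ.+ m ℤ.* ℤ.+ suc e) (sym (ℕ.*-identityʳ d)))

Σ≤-cong : ∀ n {f g : ℕ → ℚ} → (∀ k → f k ≡ g k) → Σ≤ n f ≡ Σ≤ n g
Σ≤-cong zero    f≗g = f≗g 0
Σ≤-cong (suc n) f≗g = cong₂ _+_ (Σ≤-cong n f≗g) (f≗g (suc n))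

Σ≤-+ : ∀ n (f g : ℕ → ℚ) → Σ≤ n (λ k → f k + g k) ≡ Σ≤ n f + Σ≤ n g
Σ≤-+ zero    f g = refl
Σ≤-+ (suc n) f g = trans (cong (_+ (f (suc n) + g (suc n))) (Σ≤-+ n f g))
                         (interchange (Σ≤ n f) (Σ≤ n g) (f (suc n)) (g (suc n)))
  where
  interchange : ∀ a b c d → (a + b) + (c + d) ≡ (a + c) + (b + d)
  interchange = solve-∀ ℚ-ring

Σ≤-*ˡ : ∀ n a (f : ℕ → ℚ) → Σ≤ n (λ k → a * f k) ≡ a * Σ≤ n f
Σ≤-*ˡ zero    a f = refl
Σ≤-*ˡ (suc n) a f = trans (cong (_+ a * f (suc n)) (Σ≤-*ˡ n a f))
                          (sym (*-distribˡ-+ a (Σ≤ n f) (f (suc n))))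

Σ≤-neg : ∀ n (f : ℕ → ℚ) → Σ≤ n (λ k → - f k) ≡ - Σ≤ n f
Σ≤-neg zero    f = refl
Σ≤-neg (suc n) f = trans (cong (_+ - f (suc n)) (Σ≤-neg n f))
                         (sym (neg-distrib-+ (Σ≤ n f) (f (suc n))))

Σ≤-sucˡ : ∀ n (f : ℕ → ℚ) → Σ≤ (suc n) f ≡ f 0 + Σ≤ n (λ k → f (suc k))
Σ≤-sucˡ zero    f = refl
Σ≤-sucˡ (suc n) f = trans (cong (_+ f (suc (suc n))) (Σ≤-sucˡ n f))
                          (+-assoc (f 0) (Σ≤ n (λ k → f (suc k))) (f (suc (suc n))))

binomialTransform : ℕ → (ℕ → ℚ) → ℚ
binomialTransform n f = Σ≤ n (λ k → ℕtoℚ (n C k) * f k)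

binomialTransform-sucʳ : ∀ n (f : ℕ → ℚ) →
  binomialTransform (suc n) f ≡ Σ≤ n (λ k → ℕtoℚ (suc n C k) * f k) + f (suc n)
binomialTransform-sucʳ n f = cong (_+_ (Σ≤ n (λ k → ℕtoℚ (suc n C k) * f k))) (begin
  ℕtoℚ (suc n C suc n) * f (suc n)   ≡⟨ cong (λ c → ℕtoℚ c * f (suc n)) (nCn≡1 (suc n)) ⟩
  1ℚ * f (suc n)                     ≡⟨ *-identityˡ (f (suc n)) ⟩
  f (suc n)                          ∎)
  where open ≡-Reasoning

binomialTransform-unfoldˡ : ∀ n (f : ℕ → ℚ) →
  binomialTransform n f ≡ f 0 + Σ≤ n (λ k → ℕtoℚ (n C suc k) * f (suc k))
binomialTransform-unfoldˡ n f = begin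
  binomialTransform n f                    ≡⟨ +-identityʳ _ ⟨
  binomialTransform n f + 0ℚ               ≡⟨ cong (_+_ (binomialTransform n f)) top-vanishes ⟨
  Σ≤ (suc n) (λ k → ℕtoℚ (n C k) * f k)    ≡⟨ Σ≤-sucˡ n (λ k → ℕtoℚ (n C k) * f k) ⟩
  1ℚ * f 0 + upper                         ≡⟨ cong (_+ upper) (*-identityˡ (f 0)) ⟩
  f 0 + upper                              ∎
  where
  open ≡-Reasoning
  upper : ℚ
  upper = Σ≤ n (λ k → ℕtoℚ (n C suc k) * f (suc k))
  top-vanishes : ℕtoℚ (n C suc n) * f (suc n) ≡ 0ℚ
  top-vanishes = trans (cong (λ c → ℕtoℚ c * f (suc n)) (k>n⇒nCk≡0 {n} ℕ.≤-refl))
                       (*-zeroˡ (f (suc n)))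

binomialTransform-suc : ∀ n (f : ℕ → ℚ) →
  binomialTransform (suc n) f ≡ binomialTransform n f + binomialTransform n (λ k → f (suc k))
binomialTransform-suc n f = begin
  binomialTransform (suc n) f
    ≡⟨ Σ≤-sucˡ n (λ k → ℕtoℚ (suc n C k) * f k) ⟩
  1ℚ * f 0 + Σ≤ n (λ k → ℕtoℚ (suc n C suc k) * f (suc k))
    ≡⟨ cong₂ _+_ (*-identityˡ (f 0)) (Σ≤-cong n pascal) ⟩
  f 0 + Σ≤ n (λ k → ℕtoℚ (n C k) * f (suc k) + ℕtoℚ (n C suc k) * f (suc k))
    ≡⟨ cong (_+_ (f 0)) (Σ≤-+ n (λ k → ℕtoℚ (n C k) * f (suc k))
                                 (λ k → ℕtoℚ (n C suc k) * f (suc k))) ⟩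
  f 0 + (shifted + upper)
    ≡⟨ regroup (f 0) shifted upper ⟩
  (f 0 + upper) + shifted
    ≡⟨ cong (_+ shifted) (binomialTransform-unfoldˡ n f) ⟨
  binomialTransform n f + shifted
    ∎
  where
  open ≡-Reasoning
  shifted upper : ℚ
  shifted = binomialTransform n (λ k → f (suc k))
  upper   = Σ≤ n (λ k → ℕtoℚ (n C suc k) * f (suc k))
  pascal : ∀ k →
    ℕtoℚ (suc n C suc k) * f (suc k) ≡ ℕtoℚ (n C k) * f (suc k) + ℕtoℚ (n C suc k) * f (suc k)
  pascal k = begin
    ℕtoℚ (suc n C suc k) * f (suc k)
      ≡⟨ cong (λ c → ℕtoℚ c * f (suc k)) (nCk+nC[k+1]≡[n+1]C[k+1] n k) ⟨
    ℕtoℚ (n C k ℕ.+ n C suc k) * f (suc k)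
      ≡⟨ cong (_* f (suc k)) (ℕtoℚ-+ (n C k) (n C suc k)) ⟩
    (ℕtoℚ (n C k) + ℕtoℚ (n C suc k)) * f (suc k)
      ≡⟨ *-distribʳ-+ (f (suc k)) (ℕtoℚ (n C k)) (ℕtoℚ (n C suc k)) ⟩
    ℕtoℚ (n C k) * f (suc k) + ℕtoℚ (n C suc k) * f (suc k)
      ∎
  regroup : ∀ a b c → a + (b + c) ≡ (a + c) + b
  regroup = solve-∀ ℚ-ring

binomialTransform-combination : ∀ n a b (f g : ℕ → ℚ) →
  binomialTransform n (λ k → a * f k + - (b * g k))
    ≡ a * binomialTransform n f + - (b * binomialTransform n g)
binomialTransform-combination n a b f g = begin
  binomialTransform n (λ k → a * f k + - (b * g k))
    ≡⟨ Σ≤-cong n (λ k → distribute (ℕtoℚ (n C k)) a b (f k) (g k)) ⟩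
  Σ≤ n (λ k → a * F k + - (b * G k))
    ≡⟨ Σ≤-+ n (λ k → a * F k) (λ k → - (b * G k)) ⟩
  Σ≤ n (λ k → a * F k) + Σ≤ n (λ k → - (b * G k))
    ≡⟨ cong₂ _+_ (Σ≤-*ˡ n a F)
                 (trans (Σ≤-neg n (λ k → b * G k)) (cong -_ (Σ≤-*ˡ n b G))) ⟩
  a * binomialTransform n f + - (b * binomialTransform n g)
    ∎
  where
  open ≡-Reasoning
  F G : ℕ → ℚ
  F k = ℕtoℚ (n C k) * f k
  G k = ℕtoℚ (n C k) * g k
  distribute : ∀ c a b x y → c * (a * x + - (b * y)) ≡ a * (c * x) + - (b * (c * y))
  distribute = solve-∀ ℚ-ring

weight : ℕ → ℚ
weight p = ℤ.+ (suc p ℕ.* suc p) / suc (suc p)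

weight*[p+2]≡[p+1]² : ∀ p → weight p * ℕtoℚ (suc (suc p)) ≡ ℕtoℚ (suc p) * ℕtoℚ (suc p)
weight*[p+2]≡[p+1]² p = trans (/-*-cancel (suc p ℕ.* suc p) (suc p)) (ℕtoℚ-* (suc p) (suc p))

[p+2]*B[1,p]≡-1 : ∀ p → ℕtoℚ (suc (suc p)) * B 1 p ≡ - 1ℚ
[p+2]*B[1,p]≡-1 p = begin
  t * B 1 p                                    ≡⟨ distribute t x (weight p) ⟩
  t * x + - (weight p * t)                     ≡⟨ cong (λ q → t * x + - q) (weight*[p+2]≡[p+1]² p) ⟩
  t * x + - (s * s)                            ≡⟨ cong₂ (λ t s → t * x + - (s * s))
                                                        (ℕtoℚ-+ 2 p) (ℕtoℚ-suc p) ⟩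
  (1ℚ + 1ℚ + x) * x + - ((1ℚ + x) * (1ℚ + x))  ≡⟨ square-gap x ⟩
  - 1ℚ                                         ∎
  where
  open ≡-Reasoning
  x s t : ℚ
  x = ℕtoℚ p
  s = ℕtoℚ (suc p)
  t = ℕtoℚ (suc (suc p))
  distribute : ∀ t x w → t * (x * 1ℚ + - (w * 1ℚ)) ≡ t * x + - (w * t)
  distribute = solve-∀ ℚ-ring
  square-gap : ∀ x → (1ℚ + 1ℚ + x) * x + - ((1ℚ + x) * (1ℚ + x)) ≡ - 1ℚ
  square-gap = solve-∀ ℚ-ring

binomialTransform-B-suc : ∀ n p →
  binomialTransform (suc n) (flip B p)
    ≡ ℕtoℚ (suc p) * binomialTransform n (flip B p)
      + - (weight p * binomialTransform n (flip B (suc p)))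
binomialTransform-B-suc n p = begin
  binomialTransform (suc n) (flip B p)         ≡⟨ binomialTransform-suc n (flip B p) ⟩
  u + binomialTransform n (λ k → B (suc k) p)  ≡⟨ cong (_+_ u) recurrence ⟩
  u + (ℕtoℚ p * u + - (weight p * v))          ≡⟨ collect u (ℕtoℚ p) (weight p) v ⟩
  (1ℚ + ℕtoℚ p) * u + - (weight p * v)         ≡⟨ cong (λ s → s * u + - (weight p * v)) (ℕtoℚ-suc p) ⟨
  ℕtoℚ (suc p) * u + - (weight p * v)          ∎
  where
  open ≡-Reasoning
  u v : ℚ
  u = binomialTransform n (flip B p)
  v = binomialTransform n (flip B (suc p))
  recurrence : binomialTransform n (λ k → B (suc k) p) ≡ ℕtoℚ p * u + - (weight p * v)
  recurrence = binomialTransform-combination n (ℕtoℚ p) (weight p) (flip B p) (flip B (suc p))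
  collect : ∀ u x w v → u + (x * u + - (w * v)) ≡ (1ℚ + x) * u + - (w * v)
  collect = solve-∀ ℚ-ring

binomialTransform-B : ∀ n p →
  binomialTransform (suc (suc n)) (flip B p) ≡ - (weight p * B (suc n) (suc p))
binomialTransform-B zero p = begin
  binomialTransform 2 (flip B p)           ≡⟨ expand (ℕtoℚ p) (B 1 p) (weight p) (B 1 (suc p)) ⟩
  (1ℚ + (1ℚ + 1ℚ + ℕtoℚ p) * B 1 p) + - r  ≡⟨ cong (λ t → (1ℚ + t * B 1 p) + - r) (ℕtoℚ-+ 2 p) ⟨
  (1ℚ + ℕtoℚ (suc (suc p)) * B 1 p) + - r  ≡⟨ cong (λ q → (1ℚ + q) + - r) ([p+2]*B[1,p]≡-1 p) ⟩
  (1ℚ + - 1ℚ) + - r                        ≡⟨ cong (_+ - r) (+-inverseʳ 1ℚ) ⟩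
  0ℚ + - r                                 ≡⟨ +-identityˡ (- r) ⟩
  - r                                      ∎
  where
  open ≡-Reasoning
  r : ℚ
  r = weight p * B 1 (suc p)
  expand : ∀ x b w y →
    (1ℚ * 1ℚ + (1ℚ + 1ℚ) * b) + 1ℚ * (x * b + - (w * y))
      ≡ (1ℚ + (1ℚ + 1ℚ + x) * b) + - (w * y)
  expand = solve-∀ ℚ-ring
binomialTransform-B (suc n) p = begin
  binomialTransform (3 ℕ.+ n) (flip B p)
    ≡⟨ binomialTransform-B-suc (2 ℕ.+ n) p ⟩
  s * binomialTransform (2 ℕ.+ n) (flip B p) + - (w * binomialTransform (2 ℕ.+ n) (flip B (suc p)))
    ≡⟨ cong₂ (λ t t′ → s * t + - (w * t′))
             (binomialTransform-B n p) (binomialTransform-B n (suc p)) ⟩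
  s * - (w * y) + - (w * - (weight (suc p) * z))
    ≡⟨ factor s w (weight (suc p)) y z ⟩
  - (w * (s * y + - (weight (suc p) * z)))
    ∎
  where
  open ≡-Reasoning
  s w y z : ℚ
  s = ℕtoℚ (suc p)
  w = weight p
  y = B (suc n) (suc p)
  z = B (suc n) (suc (suc p))
  factor : ∀ s w w′ y z → s * - (w * y) + - (w * - (w′ * z)) ≡ - (w * (s * y + - (w′ * z)))
  factor = solve-∀ ℚ-ring

theorem1 : (n p : ℕ) → n ≥ 1 →
    Σ≤ n (λ k → ℕtoℚ (suc n C k) * B k p) ≡ - (ℕtoℚ p * B n p)
theorem1 (suc n) p _ = begin
  sum                                           ≡⟨ add-subtract sum b ⟩
  (sum + b) + - b                               ≡⟨ cong (_+ - b) (binomialTransform-sucʳ (suc n) (flip B p)) ⟨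
  binomialTransform (2 ℕ.+ n) (flip B p) + - b  ≡⟨ cong (_+ - b) (binomialTransform-B n p) ⟩
  - r + - (ℕtoℚ p * z + - r)                    ≡⟨ cancel r (ℕtoℚ p * z) ⟩
  - (ℕtoℚ p * z)                                ∎
  where
  open ≡-Reasoning
  sum b z r : ℚ
  sum = Σ≤ (suc n) (λ k → ℕtoℚ (suc (suc n) C k) * B k p)
  b   = B (2 ℕ.+ n) p
  z   = B (suc n) p
  r   = weight p * B (suc n) (suc p)
  add-subtract : ∀ a b → a ≡ (a + b) + - b
  add-subtract = solve-∀ ℚ-ring
  cancel : ∀ a c → - a + - (c + - a) ≡ - c
  cancel = solve-∀ ℚ-ring
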